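{- For $k\in\{1,2,3\}$ and even $n$, let $M_k(n)$ be the digraph with vertex set $\{0,1,\ldots,n-1\}$ (arithmetic modulo $n$) and arc sets $E(M_1(n))=\{(i,i+1): 0\le i<n\}\cup\{(i,i+2):0\le i<n\}$, $E(M_2(n))=\{(i,i+1):0\le i<n\}\cup\{(i,i+2): 0\le i<n,\ i\text{ even}\}\cup\{(i+2,i): 0<i<n,\ i\text{ odd}\}$, $E(M_3(n))=\{(i,i+1):0\le i<n\}\cup\{(i+2,i):0\le i<n\}$. Then $M_1(n)$ and $M_2(n)$ are ambi-nut digraphs for every even $n\ge 6$, and $M_3(n)$ is an ambi-nut digraph for every even $n\ge 6$ with $n\not\equiv 0\pmod 6$.
   Context: A digraph $G$ is a finite nonempty vertex set $V(G)$ with an arbitrary binary relation $\to$ on it; $(u,v)$ is an arc if $u\to v$. Write $G^+(v)=\{u: v\to u\}$ and $G^-(v)=\{u:u\to v\}$. For $\mathbf{x}\colon V(G)\to\mathbb{R}$, $\mathbf{x}\in\operatorname{Ker} G$ iff $\sum_{u\in G^+(v)}\mathbf{x}(u)=0$ for all $v$, and $\mathbf{x}\in\operatorname{CoKer} G$ iff $\sum_{u\in G^-(v)}\mathbf{x}(u)=0$ for all $v$ (these are the kernels of the adjacency matrix $A(G)$, with $A_{ij}=1$ iff $v_i\to v_j$, and of its transpose). A vector is full if it has no zero entry. $G$ is dextro-nut if $\operatorname{Ker}G$ is one-dimensional and spanned by a full vector, laevo-nut if $\operatorname{CoKer}G$ is, bi-nut if both, and ambi-nut if it is bi-nut and $\operatorname{Ker}G$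 and $\operatorname{CoKer}G$ are spanned by the same vector.
   Formalization: The vectors in Ker G and CoKer G, including the full spanning vectors, take values in ℚ instead of ℝ. -}

module Defs where

open import Data.Bool using (Bool; true; false; if_then_else_; _∨_; _∧_; not)
open import Data.Nat using (ℕ; zero; suc; _+_; _<_; _%_; _≤_)
open import Data.Nat.Divisibility using (_∣_; _∣?_)
import Data.Nat as ℕ
open import Data.Fin using (Fin; toℕ)
import Data.Fin as F
open import Data.Rational using (ℚ; 0ℚ) renaming (_+_ to _+ℚ_; _*_ to _*ℚ_)
open import Data.Product using (Σ; _×_; ∃)
open import Relation.Binary.PropositionalEquality using (_≡_; _≢_)
open import Relation.Nullary using (¬_)
open import Relation.Nullary.Decidable using (⌊_⌋)

Digraph : ℕ → Set
Digraph n = Fin n → Fin n → Bool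

sumFin : ∀ n → (Fin n → ℚ) → ℚ
sumFin zero    f = 0ℚ
sumFin (suc n) f = f F.zero +ℚ sumFin n (λ i → f (F.suc i))

outSum : ∀ {n} → Digraph n → (Fin n → ℚ) → Fin n → ℚ
outSum {n} G x v = sumFin n (λ u → if G v u then x u else 0ℚ)

inSum : ∀ {n} → Digraph n → (Fin n → ℚ) → Fin n → ℚ
inSum {n} G x v = sumFin n (λ u → if G u v then x u else 0ℚ)

InKer : ∀ {n} → Digraph n → (Fin n → ℚ) → Set
InKer G x = ∀ v → outSum G x v ≡ 0ℚ

InCoKer : ∀ {n} → Digraph n → (Fin n → ℚ) → Set
InCoKer G x = ∀ v → inSum G x v ≡ 0ℚ

Full : ∀ {n} → (Fin n → ℚ) → Set
Full x = ∀ v → x v ≢ 0ℚ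

SpannedBy : ∀ {n} → ((Fin n → ℚ) → Set) → (Fin n → ℚ) → Set
SpannedBy {n} S x = S x × (∀ y → S y → ∃ λ (c : ℚ) → ∀ v → y v ≡ c *ℚ x v)

SpannedByFull : ∀ {n} → ((Fin n → ℚ) → Set) → Set
SpannedByFull {n} S = ∃ λ (x : Fin n → ℚ) → Full x × SpannedBy S x

DextroNut : ∀ {n} → Digraph n → Set
DextroNut G = SpannedByFull (InKer G)

LaevoNut : ∀ {n} → Digraph n → Set
LaevoNut G = SpannedByFull (InCoKer G)

BiNut : ∀ {n} → Digraph n → Set
BiNut G = DextroNut G × LaevoNut G

AmbiNut : ∀ {n} → Digraph n → Set
AmbiNut {n} G = BiNut G ×
  (∃ λ (x : Fin n → ℚ) → SpannedBy (InKer G) x × SpannedBy (InCoKer G) x)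

modN : ℕ → ℕ → ℕ
modN zero    a = a
modN (suc m) a = a % suc m

-- b ≡ a (mod n), for b < n
isMod : ℕ → ℕ → ℕ → Bool
isMod n a b = ⌊ b ℕ.≟ modN n a ⌋

evenB : ℕ → Bool
evenB i = ⌊ 2 ∣? i ⌋

M₁ : ∀ n → Digraph n
M₁ n u v = isMod n (toℕ u + 1) (toℕ v) ∨ isMod n (toℕ u + 2) (toℕ v)

M₂ : ∀ n → Digraph n
M₂ n u v = isMod n (toℕ u + 1) (toℕ v)
         ∨ (evenB (toℕ u) ∧ isMod n (toℕ u + 2) (toℕ v))
         ∨ (⌊ 0 ℕ.<? toℕ v ⌋ ∧ not (evenB (toℕ v)) ∧ isMod n (toℕ v + 2) (toℕ u))

M₃ : ∀ n → Digraph n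
M₃ n u v = isMod n (toℕ u + 1) (toℕ v) ∨ isMod n (toℕ v + 2) (toℕ u)

{-# OPTIONS --safe #-}

-- Every vertex of Mₖ(n) has exactly two out-neighbours and two in-neighbours, at offsets of
-- opposite parity, so the alternating vector v ↦ (-1)^v (well defined because n is even)
-- lies in the kernel and in the cokernel. Conversely, read a kernel or cokernel vector y as
-- the n-periodic sequence Y j = y (j mod n): the equations at the vertices 2 + j are
-- two-term relations Y (a + j) = - Y (b + j), and these force Y (1 + j) = - Y j, so y is a
-- multiple of the alternating vector. For M₁ this is immediate; for M₂ the relations depend
-- on the parity of j and are chained; for M₃ they say Y (3 + j) = - Y j, so Y is 6-periodic
-- as well as n-periodic, hence 2-periodic because n ≡ 2 or 4 (mod 6), and then
-- Y (1 + j) = Y (3 + j) = - Y j.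

module Submission where

open import Defs
import Data.Nat.Properties as ℕ
import Data.Rational.Properties as ℚ
open import Algebra.Properties.CommutativeSemigroup ℕ.+-commutativeSemigroup using (x∙yz≈y∙xz)
open import Algebra.Properties.Group ℚ.+-0-group
  using (inverseˡ-unique; inverseʳ-unique; ⁻¹-involutive)
open import Data.Bool using (true; false; T; not; if_then_else_)
open import Data.Bool.Properties using (T-∨; T-∧)
open import Data.Fin using (Fin; toℕ)
import Data.Fin as Fin
open import Data.Fin.Properties using (toℕ-injective; toℕ-fromℕ<; toℕ<n; suc-injective)
open import Data.Nat
  using (ℕ; zero; suc; _+_; _*_; _∸_; _<_; _≤_; _<?_; _%_; _/_; pred; NonZero; >-nonZero; z<s; s≤s; z≤n)
open import Data.Nat.DivMod using (_mod_; m%n<n; m<n⇒m%n≡m; %-distribˡ-+; m≡m%n+[m/n]*n; %-remove-+ˡ)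
open import Data.Nat.Divisibility
  using ( _∣_; _∣?_; divides; ∣-refl; _∣0; ∣1⇒≡1; ∣m+n∣m⇒∣n; ∣m∣n⇒∣m+n; ∣n⇒∣m*n
        ; %-presˡ-∣; ∣n∣m%n⇒∣m; m%n≡0⇒n∣m)
open import Data.Product using (∃; ∃₂; _×_; _,_)
open import Data.Product.Function.NonDependent.Propositional using (_×-⇔_)
open import Data.Rational using (ℚ; 0ℚ; 1ℚ) renaming (_+_ to _+ℚ_; _*_ to _*ℚ_; -_ to -ℚ_)
open import Data.Sum using (_⊎_; inj₁; inj₂; [_,_]; swap)
open import Data.Sum.Function.Propositional using (_⊎-⇔_)
open import Function using (_∘_; id)
open import Function.Bundles using (_⇔_; mk⇔; Equivalence)
open import Function.Construct.Composition using (_⇔-∘_)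
open import Relation.Binary.PropositionalEquality
  using (_≡_; _≢_; refl; sym; trans; cong; cong₂; subst; subst₂; ≢-sym; module ≡-Reasoning)
open import Relation.Nullary using (¬_; Dec; yes; no; contradiction)
open import Relation.Nullary.Decidable
  using (⌊_⌋; toWitness; fromWitness; toWitnessFalse; fromWitnessFalse; from-no)

open Equivalence using (to; from)

even⇒odd-suc : ∀ {i} → 2 ∣ i → ¬ 2 ∣ suc i
even⇒odd-suc {i} 2∣i 2∣1+i
  with () ← ∣1⇒≡1 (∣m+n∣m⇒∣n (subst (2 ∣_) (ℕ.+-comm 1 i) 2∣1+i) 2∣i)

odd⇒even-suc : ∀ {i} → ¬ 2 ∣ i → 2 ∣ suc i
odd⇒even-suc {zero}        odd = contradiction (2 ∣0) odd
odd⇒even-suc {suc zero}    _   = ∣-refl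
odd⇒even-suc {suc (suc i)} odd = ∣m∣n⇒∣m+n ∣-refl (odd⇒even-suc (odd ∘ ∣m∣n⇒∣m+n ∣-refl))

odd⇒positive : ∀ {i} → ¬ 2 ∣ i → 0 < i
odd⇒positive {zero}  odd = contradiction (2 ∣0) odd
odd⇒positive {suc i} _   = z<s

%6≡2⊎%6≡4 : ∀ {m} → 2 ∣ m → ¬ 6 ∣ m → m % 6 ≡ 2 ⊎ m % 6 ≡ 4
%6≡2⊎%6≡4 {m} 2∣m 6∤m =
  small-even (m % 6) (m%n<n m 6) (%-presˡ-∣ 2∣m (divides 3 refl)) (6∤m ∘ m%n≡0⇒n∣m m 6)
  where
  small-even : ∀ r → r < 6 → 2 ∣ r → r ≢ 0 → r ≡ 2 ⊎ r ≡ 4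
  small-even 0 _ _   r≢0 = contradiction refl r≢0
  small-even 1 _ 2∣r _   = contradiction 2∣r (from-no (2 ∣? 1))
  small-even 2 _ _   _   = inj₁ refl
  small-even 3 _ 2∣r _   = contradiction 2∣r (from-no (2 ∣? 3))
  small-even 4 _ _   _   = inj₂ refl
  small-even 5 _ 2∣r _   = contradiction 2∣r (from-no (2 ∣? 5))
  small-even (suc (suc (suc (suc (suc (suc _)))))) (s≤s (s≤s (s≤s (s≤s (s≤s (s≤s ())))))) _ _

-- Alternating sequences

Opposite : (ℕ → ℚ) → ℕ → ℕ → Set
Opposite Y i k = Y i +ℚ Y k ≡ 0ℚ

Cancels : (ℕ → ℚ) → ℕ → ℕ → Set
Cancels Y a b = ∀ j → Opposite Y (a + j) (b + j)

Alternating : (ℕ → ℚ) → Set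
Alternating Y = Cancels Y 1 0

alt : ℕ → ℚ
alt zero    = 1ℚ
alt (suc j) = -ℚ alt j

alt-alternating : Alternating alt
alt-alternating j = ℚ.+-inverseˡ (alt j)

alt-2+ : ∀ j → alt (2 + j) ≡ alt j
alt-2+ j = ⁻¹-involutive (alt j)

alt-cancels-3-0 : Cancels alt 3 0
alt-cancels-3-0 j = trans (cong (_+ℚ alt j) (alt-2+ (1 + j))) (alt-alternating j)

alt-even+ : ∀ {d} j → 2 ∣ d → alt (d + j) ≡ alt j
alt-even+ j (divides q refl) = go q
  where
  go : ∀ q → alt (q * 2 + j) ≡ alt j
  go zero    = refl
  go (suc q) = trans (alt-2+ (q * 2 + j)) (go q)

alt≢0 : ∀ j → alt j ≢ 0ℚ
alt≢0 zero    ()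
alt≢0 (suc j) -alt≡0 = alt≢0 j (ℚ.neg-injective -alt≡0)

module _ (Y : ℕ → ℚ) where

  opposite-sym : ∀ {i k} → Opposite Y i k → Opposite Y k i
  opposite-sym {i} {k} = trans (ℚ.+-comm (Y k) (Y i))

  opposite-unique : ∀ {i k l} → Opposite Y i k → Opposite Y k l → Y i ≡ Y l
  opposite-unique {i} {k} {l} i⊥k k⊥l =
    trans (inverseˡ-unique (Y i) (Y k) i⊥k) (sym (inverseʳ-unique (Y k) (Y l) k⊥l))

  opposite-chain : ∀ {h i k l} → Opposite Y h i → Opposite Y i k → Opposite Y k l → Opposite Y h l
  opposite-chain {l = l} h⊥i i⊥k k⊥l =
    subst (λ t → t +ℚ Y l ≡ 0ℚ) (sym (opposite-unique h⊥i i⊥k)) k⊥l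

  alternating⇒≡*alt : Alternating Y → ∀ j → Y j ≡ Y 0 *ℚ alt j
  alternating⇒≡*alt alternating zero    = sym (ℚ.*-identityʳ (Y 0))
  alternating⇒≡*alt alternating (suc j) = begin
    Y (suc j)            ≡⟨ inverseˡ-unique (Y (suc j)) (Y j) (alternating j) ⟩
    -ℚ Y j               ≡⟨ cong -ℚ_ (alternating⇒≡*alt alternating j) ⟩
    -ℚ (Y 0 *ℚ alt j)    ≡⟨ ℚ.neg-distribʳ-* (Y 0) (alt j) ⟩
    Y 0 *ℚ alt (suc j)   ∎
    where open ≡-Reasoning

  module _ {n} (periodic : ∀ j → Y (n + j) ≡ Y j) where

    cancels-from : ∀ {c} a b → c ≤ n → (∀ i → Opposite Y (a + (c + i)) (b + (c + i))) → Cancels Y a b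
    cancels-from {c} a b c≤n cancels-above j =
      subst₂ (λ p q → p +ℚ q ≡ 0ℚ) (shift a) (shift b)
        (subst (λ m → Opposite Y (a + m) (b + m)) c+[n∸c+j]≡n+j (cancels-above (n ∸ c + j)))
      where
      c+[n∸c+j]≡n+j : c + (n ∸ c + j) ≡ n + j
      c+[n∸c+j]≡n+j = trans (sym (ℕ.+-assoc c (n ∸ c) j)) (cong (_+ j) (ℕ.m+[n∸m]≡n c≤n))
      shift : ∀ a → Y (a + (n + j)) ≡ Y (a + j)
      shift a = trans (cong Y (x∙yz≈y∙xz a n j)) (periodic (a + j))

    cancels-3-4⇒alternating : 3 ≤ n → Cancels Y 3 4 → Alternating Y
    cancels-3-4⇒alternating 3≤n c34 = cancels-from 1 0 3≤n (λ i → opposite-sym (c34 i))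

    cancels-3-0⇒alternating : 2 ∣ n → ¬ 6 ∣ n → Cancels Y 3 0 → Alternating Y
    cancels-3-0⇒alternating 2∣n 6∤n c30 j = subst (λ t → t +ℚ Y j ≡ 0ℚ) (period-2 (1 + j)) (c30 j)
      where
      period-6 : ∀ j → Y (6 + j) ≡ Y j
      period-6 j = opposite-unique (c30 (3 + j)) (c30 j)
      period-6* : ∀ q j → Y (q * 6 + j) ≡ Y j
      period-6* zero    j = refl
      period-6* (suc q) j = trans (period-6 (q * 6 + j)) (period-6* q j)
      period-n%6 : ∀ j → Y (n % 6 + j) ≡ Y j
      period-n%6 j = begin
        Y (n % 6 + j)               ≡⟨ period-6* (n / 6) (n % 6 + j) ⟨
        Y (n / 6 * 6 + (n % 6 + j)) ≡⟨ cong Y (x∙yz≈y∙xz (n / 6 * 6) (n % 6) j) ⟩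
        Y (n % 6 + (n / 6 * 6 + j)) ≡⟨ cong Y (ℕ.+-assoc (n % 6) (n / 6 * 6) j) ⟨
        Y (n % 6 + n / 6 * 6 + j)   ≡⟨ cong (λ m → Y (m + j)) (m≡m%n+[m/n]*n n 6) ⟨
        Y (n + j)                   ≡⟨ periodic j ⟩
        Y j                         ∎
        where open ≡-Reasoning
      period-2 : ∀ j → Y (2 + j) ≡ Y j
      period-2 j with %6≡2⊎%6≡4 2∣n 6∤n
      ... | inj₁ n%6≡2 = subst (λ r → Y (r + j) ≡ Y j) n%6≡2 (period-n%6 j)
      ... | inj₂ n%6≡4 =
        trans (sym (subst (λ r → Y (r + (2 + j)) ≡ Y (2 + j)) n%6≡4 (period-n%6 (2 + j)))) (period-6 j)

    cancels-1-4⇒alternating : 2 ∣ n → ¬ 6 ∣ n → 1 ≤ n → Cancels Y 1 4 → Alternating Y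
    cancels-1-4⇒alternating 2∣n 6∤n 1≤n c14 =
      cancels-3-0⇒alternating 2∣n 6∤n (cancels-from 3 0 1≤n (λ i → opposite-sym (c14 i)))

    parity-cancels-3-4-3-0⇒alternating : 4 ≤ n →
      (∀ j → 2 ∣ j → Opposite Y (3 + j) (4 + j)) → (∀ j → ¬ 2 ∣ j → Opposite Y (3 + j) j) →
      Alternating Y
    parity-cancels-3-4-3-0⇒alternating 4≤n even odd = cancels-from 1 0 4≤n step
      where
      step : ∀ i → Opposite Y (5 + i) (4 + i)
      step i with 2 ∣? i
      ... | yes 2∣i = opposite-chain (even (2 + i) 2∣2+i) (odd (3 + i) (even⇒odd-suc 2∣2+i)) (even i 2∣i)
        where
        2∣2+i : 2 ∣ 2 + i
        2∣2+i = ∣m∣n⇒∣m+n ∣-refl 2∣i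
      ... | no  2∤i = opposite-sym (even (1 + i) (odd⇒even-suc 2∤i))

    parity-cancels-1-0-1-4⇒alternating : 2 ≤ n →
      (∀ j → 2 ∣ j → Opposite Y (1 + j) j) → (∀ j → ¬ 2 ∣ j → Opposite Y (1 + j) (4 + j)) →
      Alternating Y
    parity-cancels-1-0-1-4⇒alternating 2≤n even odd = cancels-from 1 0 2≤n step
      where
      step : ∀ i → Opposite Y (3 + i) (2 + i)
      step i with 2 ∣? i
      ... | yes 2∣i = even (2 + i) (∣m∣n⇒∣m+n ∣-refl 2∣i)
      ... | no  2∤i = opposite-chain (opposite-sym (even (3 + i) (∣m∣n⇒∣m+n ∣-refl 2∣1+i)))
                        (opposite-sym (odd i 2∤i)) (opposite-sym (even (1 + i) 2∣1+i))
        where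
        2∣1+i : 2 ∣ 1 + i
        2∣1+i = odd⇒even-suc 2∤i

T-⌊⌋ : ∀ {P : Set} (p? : Dec P) → T ⌊ p? ⌋ ⇔ P
T-⌊⌋ p? = mk⇔ toWitness fromWitness

T-not-⌊⌋ : ∀ {P : Set} (p? : Dec P) → T (not ⌊ p? ⌋) ⇔ (¬ P)
T-not-⌊⌋ p? = mk⇔ toWitnessFalse fromWitnessFalse

if-T : ∀ {A : Set} {b} {x y : A} → T b → (if b then x else y) ≡ x
if-T {b = true} _ = refl

if-¬T : ∀ {A : Set} {b} {x y : A} → ¬ T b → (if b then x else y) ≡ y
if-¬T {b = true}  ¬t = contradiction _ ¬t
if-¬T {b = false} _  = refl

sumFin-zero : ∀ n (f : Fin n → ℚ) → (∀ u → f u ≡ 0ℚ) → sumFin n f ≡ 0ℚ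
sumFin-zero zero    f f≡0 = refl
sumFin-zero (suc n) f f≡0 =
  trans (cong₂ _+ℚ_ (f≡0 Fin.zero) (sumFin-zero n (f ∘ Fin.suc) (f≡0 ∘ Fin.suc))) (ℚ.+-identityˡ 0ℚ)

sumFin-single : ∀ n (f : Fin n → ℚ) a → (∀ u → u ≢ a → f u ≡ 0ℚ) → sumFin n f ≡ f a
sumFin-single (suc n) f Fin.zero f≡0 =
  trans (cong (f Fin.zero +ℚ_) (sumFin-zero n (f ∘ Fin.suc) (λ u → f≡0 (Fin.suc u) λ ())))
        (ℚ.+-identityʳ (f Fin.zero))
sumFin-single (suc n) f (Fin.suc a) f≡0 =
  trans (cong₂ _+ℚ_ (f≡0 Fin.zero λ ())
                    (sumFin-single n (f ∘ Fin.suc) a (λ u u≢a → f≡0 (Fin.suc u) (u≢a ∘ suc-injective))))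
        (ℚ.+-identityˡ (f (Fin.suc a)))

sumFin-pair : ∀ n (f : Fin n → ℚ) a b → a ≢ b → (∀ u → u ≢ a → u ≢ b → f u ≡ 0ℚ) →
              sumFin n f ≡ f a +ℚ f b
sumFin-pair (suc n) f Fin.zero Fin.zero a≢b _ = contradiction refl a≢b
sumFin-pair (suc n) f Fin.zero (Fin.suc b) _ f≡0 =
  cong (f Fin.zero +ℚ_)
       (sumFin-single n (f ∘ Fin.suc) b (λ u u≢b → f≡0 (Fin.suc u) (λ ()) (u≢b ∘ suc-injective)))
sumFin-pair (suc n) f (Fin.suc a) Fin.zero _ f≡0 =
  trans (cong (f Fin.zero +ℚ_)
              (sumFin-single n (f ∘ Fin.suc) a (λ u u≢a → f≡0 (Fin.suc u) (u≢a ∘ suc-injective) (λ ()))))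
        (ℚ.+-comm (f Fin.zero) (f (Fin.suc a)))
sumFin-pair (suc n) f (Fin.suc a) (Fin.suc b) a≢b f≡0 =
  trans (cong₂ _+ℚ_ (f≡0 Fin.zero (λ ()) (λ ()))
                    (sumFin-pair n (f ∘ Fin.suc) a b (a≢b ∘ cong Fin.suc)
                       (λ u u≢a u≢b → f≡0 (Fin.suc u) (u≢a ∘ suc-injective) (u≢b ∘ suc-injective))))
        (ℚ.+-identityˡ (f (Fin.suc a) +ℚ f (Fin.suc b)))

-- InCoKer G is InKer (G ᵀ) by definition.
_ᵀ : ∀ {n} → Digraph n → Digraph n
(G ᵀ) u v = G v u

record OutPair {n} (G : Digraph n) (w a b : Fin n) : Set where
  constructor outPair
  field
    distinct : a ≢ b
    arc⇔     : ∀ u → T (G w u) ⇔ (u ≡ a ⊎ u ≡ b)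

OutPair-swap : ∀ {n} {G : Digraph n} {w a b} → OutPair G w a b → OutPair G w b a
OutPair-swap (outPair a≢b arc⇔) = outPair (≢-sym a≢b) (λ u → mk⇔ swap swap ⇔-∘ arc⇔ u)

outSum-pair : ∀ {n} {G : Digraph n} {w a b} (x : Fin n → ℚ) → OutPair G w a b → outSum G x w ≡ x a +ℚ x b
outSum-pair {n} {G} {w} {a} {b} x (outPair a≢b arc⇔) =
  trans (sumFin-pair n _ a b a≢b outside) (cong₂ _+ℚ_ (inside a (inj₁ refl)) (inside b (inj₂ refl)))
  where
  inside : ∀ u → u ≡ a ⊎ u ≡ b → (if G w u then x u else 0ℚ) ≡ x u
  inside u = if-T ∘ from (arc⇔ u)
  outside : ∀ u → u ≢ a → u ≢ b → (if G w u then x u else 0ℚ) ≡ 0ℚ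
  outside u u≢a u≢b = if-¬T ([ u≢a , u≢b ] ∘ to (arc⇔ u))

InKer-pair : ∀ {n} {G : Digraph n} {y w a b} → InKer G y → OutPair G w a b → y a +ℚ y b ≡ 0ℚ
InKer-pair {y = y} {w} ker pair = trans (sym (outSum-pair y pair)) (ker w)

ambiNut : ∀ {n} {G : Digraph n} {x} → Full x → SpannedBy (InKer G) x → SpannedBy (InCoKer G) x → AmbiNut G
ambiNut full ker coker = ((_ , full , ker) , (_ , full , coker)) , _ , ker , coker

-- Residues modulo n

modN≡% : ∀ n .{{_ : NonZero n}} a → modN n a ≡ a % n
modN≡% (suc _) a = refl

module Residues (n : ℕ) {{_ : NonZero n}} where

  [_] : ℕ → Fin n
  [ a ] = a mod n

  toℕ-[] : ∀ a → toℕ [ a ] ≡ a % n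
  toℕ-[] a = toℕ-fromℕ< (m%n<n a n)

  %≡⇒[]≡ : ∀ {a b} → a % n ≡ b % n → [ a ] ≡ [ b ]
  %≡⇒[]≡ {a} {b} a%n≡b%n = toℕ-injective (trans (toℕ-[] a) (trans a%n≡b%n (sym (toℕ-[] b))))

  []≡⇒%≡ : ∀ {a b} → [ a ] ≡ [ b ] → a % n ≡ b % n
  []≡⇒%≡ {a} {b} [a]≡[b] = trans (sym (toℕ-[] a)) (trans (cong toℕ [a]≡[b]) (toℕ-[] b))

  []-toℕ : ∀ u → [ toℕ u ] ≡ u
  []-toℕ u = toℕ-injective (trans (toℕ-[] (toℕ u)) (m<n⇒m%n≡m (toℕ<n u)))

  []-n+ : ∀ a → [ n + a ] ≡ [ a ]
  []-n+ a = %≡⇒[]≡ (%-remove-+ˡ a ∣-refl)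

  []-cong-+ : ∀ k {a b} → [ a ] ≡ [ b ] → [ k + a ] ≡ [ k + b ]
  []-cong-+ k {a} {b} [a]≡[b] = %≡⇒[]≡ (begin
    (k + a) % n           ≡⟨ %-distribˡ-+ k a n ⟩
    (k % n + a % n) % n   ≡⟨ cong (λ r → (k % n + r) % n) ([]≡⇒%≡ [a]≡[b]) ⟩
    (k % n + b % n) % n   ≡⟨ %-distribˡ-+ k b n ⟨
    (k + b) % n           ∎)
    where open ≡-Reasoning

  pred-n+suc : ∀ a → pred n + suc a ≡ n + a
  pred-n+suc a = trans (ℕ.+-suc (pred n) a) (cong (_+ a) (ℕ.suc-pred n))

  []-suc-injective : ∀ {a b} → [ suc a ] ≡ [ suc b ] → [ a ] ≡ [ b ]
  []-suc-injective {a} {b} [1+a]≡[1+b] = begin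
    [ a ]              ≡⟨ []-n+ a ⟨
    [ n + a ]          ≡⟨ cong [_] (pred-n+suc a) ⟨
    [ pred n + suc a ] ≡⟨ []-cong-+ (pred n) [1+a]≡[1+b] ⟩
    [ pred n + suc b ] ≡⟨ cong [_] (pred-n+suc b) ⟩
    [ n + b ]          ≡⟨ []-n+ b ⟩
    [ b ]              ∎
    where open ≡-Reasoning

  []-cancelˡ-+ : ∀ k {a b} → [ k + a ] ≡ [ k + b ] → [ a ] ≡ [ b ]
  []-cancelˡ-+ zero    = id
  []-cancelˡ-+ (suc k) = []-cancelˡ-+ k ∘ []-suc-injective

  []-+-surjective : ∀ k w → ∃ λ j → w ≡ [ k + j ]
  []-+-surjective zero    w = toℕ w , sym ([]-toℕ w)
  []-+-surjective (suc k) w with []-+-surjective k w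
  ... | j , w≡[k+j] = pred n + j , trans w≡[k+j] (begin
    [ k + j ]                    ≡⟨ []-cong-+ k ([]-n+ j) ⟨
    [ k + (n + j) ]              ≡⟨ cong (λ m → [ k + (m + j) ]) (ℕ.suc-pred n) ⟨
    [ k + (suc (pred n) + j) ]   ≡⟨ cong [_] (ℕ.+-suc k (pred n + j)) ⟩
    [ suc k + (pred n + j) ]     ∎)
    where open ≡-Reasoning

  []-distinct : ∀ {d} j → 0 < d → d < n → [ j ] ≢ [ d + j ]
  []-distinct {d} j 0<d d<n [j]≡[d+j] = ℕ.<⇒≢ 0<d (begin
    0       ≡⟨ m<n⇒m%n≡m (ℕ.<-trans 0<d d<n) ⟨
    0 % n   ≡⟨ []≡⇒%≡ ([]-cancelˡ-+ j [j+0]≡[j+d]) ⟩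
    d % n   ≡⟨ m<n⇒m%n≡m d<n ⟩
    d       ∎)
    where
    open ≡-Reasoning
    [j+0]≡[j+d] : [ j + 0 ] ≡ [ j + d ]
    [j+0]≡[j+d] = subst₂ (λ a b → [ a ] ≡ [ b ]) (sym (ℕ.+-identityʳ j)) (ℕ.+-comm d j) [j]≡[d+j]

  T-isMod : ∀ a w → T (isMod n a (toℕ w)) ⇔ w ≡ [ a ]
  T-isMod a w = mk⇔
    (λ t → toℕ-injective (trans (toWitness t) (trans (modN≡% n a) (sym (toℕ-[] a)))))
    (λ w≡[a] → fromWitness (trans (cong toℕ w≡[a]) (trans (toℕ-[] a) (sym (modN≡% n a)))))

  T-isMod-from : ∀ j k u → T (isMod n (toℕ [ j ] + k) (toℕ u)) ⇔ u ≡ [ k + j ]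
  T-isMod-from j k u =
    subst (λ v → T (isMod n (toℕ [ j ] + k) (toℕ u)) ⇔ u ≡ v) [[j]+k]≡[k+j] (T-isMod _ u)
    where
    [[j]+k]≡[k+j] : [ toℕ [ j ] + k ] ≡ [ k + j ]
    [[j]+k]≡[k+j] = trans (cong [_] (ℕ.+-comm (toℕ [ j ]) k)) ([]-cong-+ k ([]-toℕ [ j ]))

  T-isMod-to : ∀ j k u → T (isMod n (toℕ u + k) (toℕ [ k + j ])) ⇔ u ≡ [ j ]
  T-isMod-to j k u = mk⇔
    (λ t → sym (trans ([]-cancelˡ-+ k (trans (to (T-isMod _ _) t) [u+k]≡[k+u])) ([]-toℕ u)))
    (λ u≡[j] → from (T-isMod _ _)
                 (trans ([]-cong-+ k (trans (sym u≡[j]) (sym ([]-toℕ u)))) (sym [u+k]≡[k+u])))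
    where
    [u+k]≡[k+u] : [ toℕ u + k ] ≡ [ k + toℕ u ]
    [u+k]≡[k+u] = cong [_] (ℕ.+-comm (toℕ u) k)

  xalt : Fin n → ℚ
  xalt u = alt (toℕ u)

  xalt-full : Full xalt
  xalt-full u = alt≢0 (toℕ u)

  spannedBy-xalt : ∀ {S : (Fin n → ℚ) → Set} →
                   S xalt → (∀ y → S y → Alternating (y ∘ [_])) → SpannedBy S xalt
  spannedBy-xalt S-xalt alternating = S-xalt , λ y S-y → y [ 0 ] , λ u → begin
    y u                    ≡⟨ cong y ([]-toℕ u) ⟨
    y [ toℕ u ]            ≡⟨ alternating⇒≡*alt (y ∘ [_]) (alternating y S-y) (toℕ u) ⟩
    y [ 0 ] *ℚ xalt u      ∎
    where open ≡-Reasoning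

  SignBalanced : Digraph n → Fin n → Set
  SignBalanced G w = ∃₂ λ a b → OutPair G w [ a ] [ b ] × alt a +ℚ alt b ≡ 0ℚ

  module _ (2∣n : 2 ∣ n) where

    2∣[]⇔ : ∀ j → 2 ∣ toℕ [ j ] ⇔ 2 ∣ j
    2∣[]⇔ j = mk⇔ (λ 2∣[j] → ∣n∣m%n⇒∣m 2∣n (subst (2 ∣_) (toℕ-[] j) 2∣[j]))
                  (λ 2∣j → subst (2 ∣_) (sym (toℕ-[] j)) (%-presˡ-∣ 2∣j 2∣n))

    xalt-[] : ∀ j → xalt [ j ] ≡ alt j
    xalt-[] j = begin
      alt (toℕ [ j ])          ≡⟨ cong alt (toℕ-[] j) ⟩
      alt (j % n)              ≡⟨ alt-even+ (j % n) (∣n⇒∣m*n (j / n) 2∣n) ⟨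
      alt (j / n * n + j % n)  ≡⟨ cong alt (ℕ.+-comm (j / n * n) (j % n)) ⟩
      alt (j % n + j / n * n)  ≡⟨ cong alt (m≡m%n+[m/n]*n j n) ⟨
      alt j                    ∎
      where open ≡-Reasoning

    InKer-xalt : ∀ {G} → (∀ j → SignBalanced G [ 2 + j ]) → InKer G xalt
    InKer-xalt balanced w with []-+-surjective 2 w
    ... | j , refl with balanced j
    ... | a , b , pair , alt-a+alt-b≡0 =
      trans (outSum-pair xalt pair) (trans (cong₂ _+ℚ_ (xalt-[] a) (xalt-[] b)) alt-a+alt-b≡0)

-- The digraphs M₁, M₂ and M₃

module Mₖ (n : ℕ) (4≤n : 4 ≤ n) (2∣n : 2 ∣ n) where

  instance
    n≢0 : NonZero n
    n≢0 = >-nonZero (ℕ.<-≤-trans z<s 4≤n)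

  open Residues n

  1<n : 1 < n
  1<n = ℕ.<-≤-trans (s≤s (s≤s z≤n)) 4≤n

  periodic : ∀ (y : Fin n → ℚ) j → y [ n + j ] ≡ y [ j ]
  periodic y j = cong y ([]-n+ j)

  -- Neighbourhoods are described at the vertex [ 2 + j ], so that every neighbour is some
  -- [ a + j ] and no subtraction modulo n occurs.
  M₁-out : ∀ j → OutPair (M₁ n) [ 2 + j ] [ 3 + j ] [ 4 + j ]
  M₁-out j = outPair ([]-distinct (3 + j) z<s 1<n)
    (λ u → (T-isMod-from (2 + j) 1 u ⊎-⇔ T-isMod-from (2 + j) 2 u) ⇔-∘ T-∨)

  M₁-in : ∀ j → OutPair (M₁ n ᵀ) [ 2 + j ] [ 1 + j ] [ j ]
  M₁-in j = outPair (≢-sym ([]-distinct j z<s 1<n))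
    (λ u → (T-isMod-to (1 + j) 1 u ⊎-⇔ T-isMod-to j 2 u) ⇔-∘ T-∨)

  M₃-out : ∀ j → OutPair (M₃ n) [ 2 + j ] [ 3 + j ] [ j ]
  M₃-out j = outPair (≢-sym ([]-distinct j z<s 4≤n))
    (λ u → (T-isMod-from (2 + j) 1 u ⊎-⇔ T-isMod-to j 2 u) ⇔-∘ T-∨)

  M₃-in : ∀ j → OutPair (M₃ n ᵀ) [ 2 + j ] [ 1 + j ] [ 4 + j ]
  M₃-in j = outPair ([]-distinct (1 + j) z<s 4≤n)
    (λ u → (T-isMod-to (1 + j) 1 u ⊎-⇔ T-isMod-from (2 + j) 2 u) ⇔-∘ T-∨)

  M₁-ambiNut : AmbiNut (M₁ n)
  M₁-ambiNut = ambiNut xalt-full kernel cokernel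
    where
    kernel : SpannedBy (InKer (M₁ n)) xalt
    kernel = spannedBy-xalt
      (InKer-xalt 2∣n λ j → 4 + j , 3 + j , OutPair-swap (M₁-out j) , alt-alternating (3 + j))
      (λ y ker → cancels-3-4⇒alternating (y ∘ [_]) (periodic y) (ℕ.<⇒≤ 4≤n)
                   λ j → InKer-pair ker (M₁-out j))
    cokernel : SpannedBy (InCoKer (M₁ n)) xalt
    cokernel = spannedBy-xalt
      (InKer-xalt 2∣n λ j → 1 + j , j , M₁-in j , alt-alternating j)
      (λ y coker j → InKer-pair coker (M₁-in j))

  M₃-ambiNut : ¬ 6 ∣ n → AmbiNut (M₃ n)
  M₃-ambiNut 6∤n = ambiNut xalt-full kernel cokernel
    where
    kernel : SpannedBy (InKer (M₃ n)) xalt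
    kernel = spannedBy-xalt
      (InKer-xalt 2∣n λ j → 3 + j , j , M₃-out j , alt-cancels-3-0 j)
      (λ y ker → cancels-3-0⇒alternating (y ∘ [_]) (periodic y) 2∣n 6∤n
                   λ j → InKer-pair ker (M₃-out j))
    cokernel : SpannedBy (InCoKer (M₃ n)) xalt
    cokernel = spannedBy-xalt
      (InKer-xalt 2∣n λ j → 4 + j , 1 + j , OutPair-swap (M₃-in j) , alt-cancels-3-0 (1 + j))
      (λ y coker → cancels-1-4⇒alternating (y ∘ [_]) (periodic y) 2∣n 6∤n (ℕ.<⇒≤ 1<n)
                     λ j → InKer-pair coker (M₃-in j))

  2∣[2+]⇔ : ∀ j → 2 ∣ toℕ [ 2 + j ] ⇔ 2 ∣ j
  2∣[2+]⇔ j = mk⇔ (λ 2∣2+j → ∣m+n∣m⇒∣n 2∣2+j ∣-refl) (∣m∣n⇒∣m+n ∣-refl)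
              ⇔-∘ 2∣[]⇔ 2∣n (2 + j)

  M₂-out-⇔ : ∀ j u → T (M₂ n [ 2 + j ] u) ⇔
    (u ≡ [ 3 + j ] ⊎ (2 ∣ toℕ [ 2 + j ] × u ≡ [ 4 + j ])
                   ⊎ (0 < toℕ u × ¬ 2 ∣ toℕ u × u ≡ [ j ]))
  M₂-out-⇔ j u =
    (T-isMod-from (2 + j) 1 u
      ⊎-⇔ ((((T-⌊⌋ (2 ∣? toℕ [ 2 + j ]) ×-⇔ T-isMod-from (2 + j) 2 u) ⇔-∘ T-∧)
           ⊎-⇔ ((T-⌊⌋ (0 <? toℕ u)
                  ×-⇔ ((T-not-⌊⌋ (2 ∣? toℕ u) ×-⇔ T-isMod-to j 2 u) ⇔-∘ T-∧))
                 ⇔-∘ T-∧))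
          ⇔-∘ T-∨))
    ⇔-∘ T-∨

  M₂-in-⇔ : ∀ j u → T (M₂ n u [ 2 + j ]) ⇔
    (u ≡ [ 1 + j ] ⊎ (2 ∣ toℕ u × u ≡ [ j ])
                   ⊎ (0 < toℕ [ 2 + j ] × ¬ 2 ∣ toℕ [ 2 + j ] × u ≡ [ 4 + j ]))
  M₂-in-⇔ j u =
    (T-isMod-to (1 + j) 1 u
      ⊎-⇔ ((((T-⌊⌋ (2 ∣? toℕ u) ×-⇔ T-isMod-to j 2 u) ⇔-∘ T-∧)
           ⊎-⇔ ((T-⌊⌋ (0 <? toℕ [ 2 + j ])
                  ×-⇔ ((T-not-⌊⌋ (2 ∣? toℕ [ 2 + j ]) ×-⇔ T-isMod-from (2 + j) 2 u) ⇔-∘ T-∧))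
                 ⇔-∘ T-∧))
          ⇔-∘ T-∨))
    ⇔-∘ T-∨

  M₂-out-even : ∀ j → 2 ∣ j → OutPair (M₂ n) [ 2 + j ] [ 3 + j ] [ 4 + j ]
  M₂-out-even j 2∣j = outPair ([]-distinct (3 + j) z<s 1<n) (λ u → mk⇔
    (λ { (inj₁ u≡[3+j]) → inj₁ u≡[3+j]
       ; (inj₂ (inj₁ (_ , u≡[4+j]))) → inj₂ u≡[4+j]
       ; (inj₂ (inj₂ (_ , 2∤[j] , refl))) → contradiction (from (2∣[]⇔ 2∣n j) 2∣j) 2∤[j] })
    (λ { (inj₁ u≡[3+j]) → inj₁ u≡[3+j]
       ; (inj₂ u≡[4+j]) → inj₂ (inj₁ (from (2∣[2+]⇔ j) 2∣j , u≡[4+j])) })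
    ⇔-∘ M₂-out-⇔ j u)

  M₂-out-odd : ∀ j → ¬ 2 ∣ j → OutPair (M₂ n) [ 2 + j ] [ 3 + j ] [ j ]
  M₂-out-odd j 2∤j = outPair (≢-sym ([]-distinct j z<s 4≤n)) (λ u → mk⇔
    (λ { (inj₁ u≡[3+j]) → inj₁ u≡[3+j]
       ; (inj₂ (inj₁ (2∣[2+j] , _))) → contradiction (to (2∣[2+]⇔ j) 2∣[2+j]) 2∤j
       ; (inj₂ (inj₂ (_ , _ , u≡[j]))) → inj₂ u≡[j] })
    (λ { (inj₁ u≡[3+j]) → inj₁ u≡[3+j]
       ; (inj₂ refl) → inj₂ (inj₂ (odd⇒positive 2∤[j] , 2∤[j] , refl)) })
    ⇔-∘ M₂-out-⇔ j u)
    where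
    2∤[j] : ¬ 2 ∣ toℕ [ j ]
    2∤[j] = 2∤j ∘ to (2∣[]⇔ 2∣n j)

  M₂-in-even : ∀ j → 2 ∣ j → OutPair (M₂ n ᵀ) [ 2 + j ] [ 1 + j ] [ j ]
  M₂-in-even j 2∣j = outPair (≢-sym ([]-distinct j z<s 1<n)) (λ u → mk⇔
    (λ { (inj₁ u≡[1+j]) → inj₁ u≡[1+j]
       ; (inj₂ (inj₁ (_ , u≡[j]))) → inj₂ u≡[j]
       ; (inj₂ (inj₂ (_ , 2∤[2+j] , _))) → contradiction (from (2∣[2+]⇔ j) 2∣j) 2∤[2+j] })
    (λ { (inj₁ u≡[1+j]) → inj₁ u≡[1+j]
       ; (inj₂ refl) → inj₂ (inj₁ (from (2∣[]⇔ 2∣n j) 2∣j , refl)) })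
    ⇔-∘ M₂-in-⇔ j u)

  M₂-in-odd : ∀ j → ¬ 2 ∣ j → OutPair (M₂ n ᵀ) [ 2 + j ] [ 1 + j ] [ 4 + j ]
  M₂-in-odd j 2∤j = outPair ([]-distinct (1 + j) z<s 4≤n) (λ u → mk⇔
    (λ { (inj₁ u≡[1+j]) → inj₁ u≡[1+j]
       ; (inj₂ (inj₁ (2∣[j] , refl))) → contradiction (to (2∣[]⇔ 2∣n j) 2∣[j]) 2∤j
       ; (inj₂ (inj₂ (_ , _ , u≡[4+j]))) → inj₂ u≡[4+j] })
    (λ { (inj₁ u≡[1+j]) → inj₁ u≡[1+j]
       ; (inj₂ u≡[4+j]) → inj₂ (inj₂ (odd⇒positive 2∤[2+j] , 2∤[2+j] , u≡[4+j])) })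
    ⇔-∘ M₂-in-⇔ j u)
    where
    2∤[2+j] : ¬ 2 ∣ toℕ [ 2 + j ]
    2∤[2+j] = 2∤j ∘ to (2∣[2+]⇔ j)

  M₂-ambiNut : AmbiNut (M₂ n)
  M₂-ambiNut = ambiNut xalt-full kernel cokernel
    where
    out-balanced : ∀ j → SignBalanced (M₂ n) [ 2 + j ]
    out-balanced j with 2 ∣? j
    ... | yes 2∣j = 4 + j , 3 + j , OutPair-swap (M₂-out-even j 2∣j) , alt-alternating (3 + j)
    ... | no  2∤j = 3 + j , j , M₂-out-odd j 2∤j , alt-cancels-3-0 j
    in-balanced : ∀ j → SignBalanced (M₂ n ᵀ) [ 2 + j ]
    in-balanced j with 2 ∣? j
    ... | yes 2∣j = 1 + j , j , M₂-in-even j 2∣j , alt-alternating j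
    ... | no  2∤j = 4 + j , 1 + j , OutPair-swap (M₂-in-odd j 2∤j) , alt-cancels-3-0 (1 + j)
    kernel : SpannedBy (InKer (M₂ n)) xalt
    kernel = spannedBy-xalt (InKer-xalt 2∣n out-balanced)
      (λ y ker → parity-cancels-3-4-3-0⇒alternating (y ∘ [_]) (periodic y) 4≤n
                   (λ j 2∣j → InKer-pair ker (M₂-out-even j 2∣j))
                   (λ j 2∤j → InKer-pair ker (M₂-out-odd j 2∤j)))
    cokernel : SpannedBy (InCoKer (M₂ n)) xalt
    cokernel = spannedBy-xalt (InKer-xalt 2∣n in-balanced)
      (λ y coker → parity-cancels-1-0-1-4⇒alternating (y ∘ [_]) (periodic y) 1<n
                     (λ j 2∣j → InKer-pair coker (M₂-in-even j 2∣j))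
                     (λ j 2∤j → InKer-pair coker (M₂-in-odd j 2∤j)))

proposition6 : ((n : ℕ) → 6 ≤ n → 2 ∣ n → AmbiNut (M₁ n) × AmbiNut (M₂ n))
    × ((n : ℕ) → 6 ≤ n → 2 ∣ n → ¬ (6 ∣ n) → AmbiNut (M₃ n))
proposition6 =
  (λ n 6≤n 2∣n → M₁-ambiNut n (6≤⇒4≤ 6≤n) 2∣n , M₂-ambiNut n (6≤⇒4≤ 6≤n) 2∣n) ,
  (λ n 6≤n 2∣n → M₃-ambiNut n (6≤⇒4≤ 6≤n) 2∣n)
  where
  open Mₖ using (M₁-ambiNut; M₂-ambiNut; M₃-ambiNut)
  6≤⇒4≤ : ∀ {n} → 6 ≤ n → 4 ≤ n
  6≤⇒4≤ = ℕ.m+n≤o⇒n≤o 2
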